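{- If $\mathcal{R}_{\mathrm{TEQ}}$ is directed, then $\mathrm{TEQ}(T)\subseteq\mathrm{ME}(T)$ for every tournament $T$.
   Context: Let $X$ be a universe of alternatives. A tournament $T=(A,\succ)$: $A$ a non-empty finite subset of $X$, $\succ$ an asymmetric complete relation on $X$. For $B\subseteq A$ write $B$ also for $(B,\succ)$; $\overline{D}(b)=\{c\in A:c\succ b\}$; $\max_\prec(B)=\{a\in B:\text{no }b\in B\text{ with }b\succ a\}$. A tournament solution is a function $S$ on tournaments, depending only on $A$ and $\succ|_A$ and commuting with isomorphisms, with $\max_\prec(A)\subseteq S(T)\subseteq A$, $S(T)\ne\emptyset$. $\mathcal{M}^*(T)=\{B\subseteq A:\max_\prec(C)\neq\emptyset$ for every non-empty $C\subseteq B\}$ (transitive subsets). The Banks set is $\mathrm{BA}(T)=\bigcup\{\max_\prec(B): B\text{ inclusion-maximal in }\mathcal{M}^*(T)\}$. $B\subseteq A$ is $S$-stable if $a\notin S(B\cup\{a\})$ for all $a\in A\setminus B$. The minimal extending set $\mathrm{ME}(T)$ is the union of all inclusion-minimal $\mathrm{BA}$-stable sets of $T$. $B\subseteq A$ is $S$-retentive in $T$ if $B\neq\emptyset$ and $S(\overline{D}(b))\subseteq B$ for every $b\in B$ with $\overline{D}(b)\ne\emptyset$; $\mathcal{R}_S(T)$ is the set of such sets. $\mathrm{TEQ}$ is defined recursively on the order of the tournament: $\mathrm{TEQ}(T)$ is the union of all inclusion-minimal $\mathrm{TEQ}$-retentive sets of $T$. $\mathcal{R}_{\mathrm{TEQ}}$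 is directed if for every tournament $T$ and $B,C\in\mathcal{R}_{\mathrm{TEQ}}(T)$ some $D\in\mathcal{R}_{\mathrm{TEQ}}(T)$ has $D\subseteq B\cap C$. -}

module Defs where

-- Convention: every tournament is realised inside a finite ambient universe
-- Fin n carrying an asymmetric complete (decidable) relation _≻_; the
-- tournament itself is a non-empty subset A of Fin n.  All notions only
-- depend on A and ≻ restricted to A, and every finite tournament is
-- isomorphic to one of this form, so quantifying over all such data is
-- quantifying over all tournaments.  Subsets of A are Data.Fin.Subset
-- subsets of the ambient universe (contained in A).

open import Data.Nat using (ℕ; zero; suc)
open import Data.Fin using (Fin)
open import Data.Fin.Subset using (Subset; _∈_; _∉_; _⊆_; _∩_; _∪_; ⁅_⁆; Nonempty; ∣_∣)
open import Data.Fin.Subset.Properties using (_∈?_)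
open import Data.Vec using (tabulate)
open import Data.Bool using (_∧_)
open import Data.Product using (_×_; ∃; ∃-syntax)
open import Data.Sum using (_⊎_)
open import Data.Empty using (⊥)
open import Relation.Nullary using (¬_; does)
open import Relation.Binary.PropositionalEquality using (_≡_; _≢_)
open import Relation.Binary using (Rel; Decidable)
open import Level using (0ℓ)

record TournamentRel (n : ℕ) : Set₁ where
  field
    _≻_      : Rel (Fin n) 0ℓ
    _≻?_     : Decidable _≻_
    asym     : ∀ {a b} → a ≻ b → ¬ (b ≻ a)
    complete : ∀ a b → a ≢ b → (a ≻ b) ⊎ (b ≻ a)

record Tournament : Set₁ where
  field
    n       : ℕ
    rel     : TournamentRel n
    A       : Subset n
    A-nonempty : Nonempty A

-- A "set-valued function on subtournaments": S B is the (predicate) subset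
-- S(B, ≻) of B.
SolutionOn : ℕ → Set₁
SolutionOn n = Subset n → Fin n → Set

module Notions {n : ℕ} (R : TournamentRel n) where
  open TournamentRel R

  IsMax : Subset n → Fin n → Set
  IsMax B a = a ∈ B × (∀ b → b ∈ B → ¬ (b ≻ a))

  Dbar : Subset n → Fin n → Subset n
  Dbar A b = tabulate (λ c → does (c ∈? A) ∧ does (c ≻? b))

  IsTransitiveSubset : Subset n → Subset n → Set
  IsTransitiveSubset A B =
    B ⊆ A × (∀ C → Nonempty C → C ⊆ B → ∃[ a ] IsMax C a)

  MaximalTransitive : Subset n → Subset n → Set
  MaximalTransitive A B =
    IsTransitiveSubset A B ×
    (∀ B′ → IsTransitiveSubset A B′ → B ⊆ B′ → B′ ⊆ B)

  BA : SolutionOn n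
  BA A a = ∃[ B ] (MaximalTransitive A B × IsMax B a)

  Stable : SolutionOn n → Subset n → Subset n → Set
  Stable S A B = B ⊆ A × (∀ a → a ∈ A → a ∉ B → ¬ S (B ∪ ⁅ a ⁆) a)

  MinimalStable : SolutionOn n → Subset n → Subset n → Set
  MinimalStable S A B =
    Stable S A B × (∀ B′ → Stable S A B′ → B′ ⊆ B → B ⊆ B′)

  ME : SolutionOn n
  ME A a = ∃[ B ] (MinimalStable BA A B × a ∈ B)

  Retentive : SolutionOn n → Subset n → Subset n → Set
  Retentive S A B =
    Nonempty B × B ⊆ A ×
    (∀ b → b ∈ B → Nonempty (Dbar A b) → ∀ x → S (Dbar A b) x → x ∈ B)

  MinimalRetentive : SolutionOn n → Subset n → Subset n → Set
  MinimalRetentive S A B =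
    Retentive S A B × (∀ B′ → Retentive S A B′ → B′ ⊆ B → B ⊆ B′)

  -- TEQ by recursion on the order of the tournament, implemented with a fuel
  -- argument: TEQ-fuel k A is the genuine TEQ(A) whenever k ≥ ∣ A ∣, since
  -- ∣ D̄(b) ∣ < ∣ A ∣ for b ∈ A.
  TEQ-fuel : ℕ → SolutionOn n
  TEQ-fuel zero    A a = ⊥
  TEQ-fuel (suc k) A a = ∃[ B ] (MinimalRetentive (TEQ-fuel k) A B × a ∈ B)

  TEQ : SolutionOn n
  TEQ A = TEQ-fuel ∣ A ∣ A

RTEQ : (T : Tournament) → Subset (Tournament.n T) → Set
RTEQ T B = Notions.Retentive (Tournament.rel T) (Notions.TEQ (Tournament.rel T)) (Tournament.A T) B

RTEQ-Directed : Set₁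
RTEQ-Directed =
  ∀ (T : Tournament) (B C : Subset (Tournament.n T)) →
    RTEQ T B → RTEQ T C → ∃[ D ] (RTEQ T D × D ⊆ B ∩ C)

TEQof : (T : Tournament) → Fin (Tournament.n T) → Set
TEQof T = Notions.TEQ (Tournament.rel T) (Tournament.A T)

MEof : (T : Tournament) → Fin (Tournament.n T) → Set
MEof T = Notions.ME (Tournament.rel T) (Tournament.A T)

-- Every BA-stable set X of a tournament contains its TEQ, by induction on the
-- order.  For b ∈ X the set X ∩ D̄(b) is BA-stable in D̄(b): if a ∈ D̄(b) ∖ X
-- were a Banks winner of (X ∩ D̄(b)) ∪ {a}, appending b below its maximal
-- chain would give a chain of X ∪ {a} with top a that no alternative
-- dominates, making a a Banks winner of X ∪ {a}.  By induction TEQ(D̄(b)) ⊆ X,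
-- so X is TEQ-retentive.  If R is a minimal TEQ-retentive set, directedness
-- yields a retentive D ⊆ R ∩ X and minimality forces R = D ⊆ X.  Taking for X
-- a minimal BA-stable set gives TEQ ⊆ ME.
module Submission where

open import Defs
open import Level using (Level)
open import Data.Nat using (ℕ; suc; _≤_)
open import Data.Nat.Properties using (≤-refl; ≤-pred; <-≤-trans; n≤1+n; n≮0)
open import Data.Fin using (Fin)
open import Data.Fin.Properties using (_≟_; any?; all?)
open import Data.Fin.Subset using (Subset; _∈_; _∉_; _⊆_; _⊂_; _⊃_; _∩_; _∪_; ⁅_⁆; Nonempty; ∣_∣)
open import Data.Fin.Subset.Properties
  using (_∈?_; _⊆?_; _⊂?_; nonempty?; anySubset?; ⊆-refl; ⊆-trans; p⊂q⇒p⊆q; p⊂q⇒∣p∣<∣q∣;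
         x∈p⇒∣p-x∣<∣p∣; x∈⁅x⁆; x∈⁅y⁆⇒x≡y; p⊆p∪q; x∈p∪q⁺; x∈p∪q⁻; p∩q⊆p; p∩q⊆q; x∈p∩q⁺; x∈p∩q⁻)
open import Data.Fin.Subset.Induction using (⊂-wellFounded; ⊃-wellFounded)
open import Data.Vec.Properties using (lookup⇒[]=; []=⇒lookup; lookup∘tabulate)
open import Data.Bool using (true; _∧_)
open import Data.Product using (_×_; _,_; proj₁; proj₂; ∃-syntax)
open import Data.Sum using (_⊎_; inj₁; inj₂; map₂)
open import Data.Empty using (⊥-elim)
open import Function using (case_of_)
open import Induction.WellFounded using (Acc; acc)
open import Relation.Nullary using (¬_; Dec; yes; no; does; contradiction)
open import Relation.Nullary.Decidable using (_×-dec_; _→-dec_; ¬?; decidable-stable)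
open import Relation.Binary.PropositionalEquality using (_≡_; refl; sym; trans; subst)

module _ {n : ℕ} {ℓ : Level} {P : Subset n → Set ℓ} (P? : ∀ p → Dec (P p)) where

  allSubset? : Dec (∀ p → P p)
  allSubset? with anySubset? (λ p → ¬? (P? p))
  ... | yes (p , ¬Pp) = no (λ ∀P → ¬Pp (∀P p))
  ... | no ∄¬P = yes (λ p → decidable-stable (P? p) (λ ¬Pp → ∄¬P (p , ¬Pp)))

  ⊆-minimal : ∀ p → P p → ∃[ q ] (q ⊆ p × P q × (∀ r → P r → r ⊆ q → q ⊆ r))
  ⊆-minimal p = go (⊂-wellFounded p)
    where
    go : ∀ {p} → Acc _⊂_ p → P p → ∃[ q ] (q ⊆ p × P q × (∀ r → P r → r ⊆ q → q ⊆ r))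
    go {p} (acc smaller) Pp with anySubset? (λ r → P? r ×-dec r ⊂? p)
    ... | yes (r , Pr , r⊂p) =
      let q , q⊆r , Pq , q-minimal = go (smaller r⊂p) Pr
      in q , ⊆-trans q⊆r (p⊂q⇒p⊆q r⊂p) , Pq , q-minimal
    ... | no ∄r = p , ⊆-refl , Pp , λ r Pr r⊆p {x} x∈p →
      decidable-stable (x ∈? r) (λ x∉r → ∄r (r , Pr , r⊆p , x , x∈p , x∉r))

  ⊆-maximal : ∀ p → P p → ∃[ q ] (p ⊆ q × P q × (∀ r → P r → q ⊆ r → r ⊆ q))
  ⊆-maximal p = go (⊃-wellFounded p)
    where
    go : ∀ {p} → Acc _⊃_ p → P p → ∃[ q ] (p ⊆ q × P q × (∀ r → P r → q ⊆ r → r ⊆ q))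
    go {p} (acc larger) Pp with anySubset? (λ r → P? r ×-dec p ⊂? r)
    ... | yes (r , Pr , p⊂r) =
      let q , r⊆q , Pq , q-maximal = go (larger p⊂r) Pr
      in q , ⊆-trans (p⊂q⇒p⊆q p⊂r) r⊆q , Pq , q-maximal
    ... | no ∄r = p , ⊆-refl , Pp , λ r Pr p⊆r {x} x∈r →
      decidable-stable (x ∈? p) (λ x∉p → ∄r (r , Pr , p⊆r , x , x∈r , x∉p))

module _ {n : ℕ} where

  ⊆-∪⁅⁆ : ∀ {p : Subset n} {y} → p ⊆ p ∪ ⁅ y ⁆
  ⊆-∪⁅⁆ {y = y} = p⊆p∪q ⁅ y ⁆

  ∈-∪⁅⁆ : ∀ {p : Subset n} y → y ∈ p ∪ ⁅ y ⁆
  ∈-∪⁅⁆ y = x∈p∪q⁺ (inj₂ (x∈⁅x⁆ y))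

  ∈-∪⁅⁆⁻ : ∀ {p : Subset n} {x y} → x ∈ p ∪ ⁅ y ⁆ → x ∈ p ⊎ x ≡ y
  ∈-∪⁅⁆⁻ {p} {y = y} x∈ = map₂ (x∈⁅y⁆⇒x≡y y) (x∈p∪q⁻ p ⁅ y ⁆ x∈)

  ∪⁅⁆-⊆ : ∀ {p q : Subset n} {y} → p ⊆ q → y ∈ q → p ∪ ⁅ y ⁆ ⊆ q
  ∪⁅⁆-⊆ p⊆q y∈q x∈ with ∈-∪⁅⁆⁻ x∈
  ... | inj₁ x∈p = p⊆q x∈p
  ... | inj₂ refl = y∈q

module Tournaments {n : ℕ} (tr : TournamentRel n) where
  open TournamentRel tr
  open Notions tr

  private variable
    A B C R X : Subset n
    a b x z : Fin n

  ≻-irrefl : ¬ (x ≻ x)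
  ≻-irrefl x≻x = asym x≻x x≻x

  Dominates : Fin n → Subset n → Set
  Dominates z C = ∀ c → c ∈ C → z ≻ c

  ¬Dominates-self : z ∈ C → ¬ Dominates z C
  ¬Dominates-self z∈C z-dom = ≻-irrefl (z-dom _ z∈C)

  ∈-Dbar⁻ : x ∈ Dbar A b → x ∈ A × x ≻ b
  ∈-Dbar⁻ {x} {A} {b} x∈D with x ∈? A | x ≻? b | trans (sym (lookup∘tabulate _ x)) ([]=⇒lookup x∈D)
  ... | yes x∈A | yes x≻b | _ = x∈A , x≻b
  ... | yes _   | no _    | ()
  ... | no _    | _       | ()

  ∈-Dbar⁺ : x ∈ A → x ≻ b → x ∈ Dbar A b
  ∈-Dbar⁺ {x} {A} {b} x∈A x≻b = lookup⇒[]= x (Dbar A b) (trans (lookup∘tabulate _ x) is-true)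
    where
    is-true : does (x ∈? A) ∧ does (x ≻? b) ≡ true
    is-true with x ∈? A | x ≻? b
    ... | yes _ | yes _ = refl
    ... | no x∉A | _ = contradiction x∈A x∉A
    ... | yes _ | no x⊁b = contradiction x≻b x⊁b

  Dbar⊆ : Dbar A b ⊆ A
  Dbar⊆ x∈D = proj₁ (∈-Dbar⁻ x∈D)

  Dbar⊂ : b ∈ A → Dbar A b ⊂ A
  Dbar⊂ b∈A = Dbar⊆ , _ , b∈A , λ b∈D → ≻-irrefl (proj₂ (∈-Dbar⁻ b∈D))

  IsMax-⊆ : C ⊆ B → a ∈ C → IsMax B a → IsMax C a
  IsMax-⊆ C⊆B a∈C (_ , a-max) = a∈C , λ y y∈C → a-max y (C⊆B y∈C)

  IsMax-unique : IsMax C a → IsMax C b → a ≡ b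
  IsMax-unique {a = a} {b} (a∈C , a-max) (b∈C , b-max) with a ≟ b
  ... | yes a≡b = a≡b
  ... | no a≢b with complete a b a≢b
  ...   | inj₁ a≻b = contradiction a≻b (b-max a a∈C)
  ...   | inj₂ b≻a = contradiction b≻a (a-max b b∈C)

  IsMax⇒Dominates : IsMax B a → C ⊆ B → a ∉ C → Dominates a C
  IsMax⇒Dominates {a = a} (_ , a-max) C⊆B a∉C c c∈C with complete a c (λ { refl → a∉C c∈C })
  ... | inj₁ a≻c = a≻c
  ... | inj₂ c≻a = contradiction c≻a (a-max c (C⊆B c∈C))

  IsMax-∪-below : a ≻ b → IsMax B a → IsMax (B ∪ ⁅ b ⁆) a
  IsMax-∪-below a≻b (a∈B , a-max) = ⊆-∪⁅⁆ a∈B , λ y y∈ y≻a → case ∈-∪⁅⁆⁻ y∈ of λ where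
    (inj₁ y∈B) → a-max y y∈B y≻a
    (inj₂ refl) → asym a≻b y≻a

  HasMaxima : Subset n → Set
  HasMaxima B = ∀ C → Nonempty C → C ⊆ B → ∃[ a ] IsMax C a

  HasMaxima-∪-top : HasMaxima B → Dominates z B → HasMaxima (B ∪ ⁅ z ⁆)
  HasMaxima-∪-top {B} {z} B-maxima z-dom K K≠∅ K⊆ with z ∈? K
  ... | yes z∈K = z , z∈K , λ y y∈K y≻z → case ∈-∪⁅⁆⁻ (K⊆ y∈K) of λ where
    (inj₁ y∈B) → asym (z-dom y y∈B) y≻z
    (inj₂ refl) → ≻-irrefl y≻z
  ... | no z∉K = B-maxima K K≠∅ λ x∈K → case ∈-∪⁅⁆⁻ (K⊆ x∈K) of λ where
    (inj₁ x∈B) → x∈B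
    (inj₂ refl) → contradiction x∈K z∉K

  HasMaxima-∪-bottom : HasMaxima B → (∀ c → c ∈ B → c ≻ b) → HasMaxima (B ∪ ⁅ b ⁆)
  HasMaxima-∪-bottom {B} {b} B-maxima above-b K K≠∅ K⊆ with nonempty? (K ∩ B)
  ... | yes K∩B≠∅ =
    let m , m∈K∩B , m-max = B-maxima (K ∩ B) K∩B≠∅ (p∩q⊆q K B)
        m∈K , m∈B = x∈p∩q⁻ K B m∈K∩B
    in m , m∈K , λ y y∈K y≻m → case ∈-∪⁅⁆⁻ (K⊆ y∈K) of λ where
         (inj₁ y∈B) → m-max y (x∈p∩q⁺ (y∈K , y∈B)) y≻m
         (inj₂ refl) → asym (above-b m m∈B) y≻m
  ... | no K∩B-empty =
    b , subst (_∈ K) (only-b x∈K) x∈K , λ y y∈K y≻b → ≻-irrefl (subst (_≻ b) (only-b y∈K) y≻b)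
    where
    x∈K : proj₁ K≠∅ ∈ K
    x∈K = proj₂ K≠∅
    only-b : ∀ {y} → y ∈ K → y ≡ b
    only-b {y} y∈K = case ∈-∪⁅⁆⁻ (K⊆ y∈K) of λ where
      (inj₁ y∈B) → contradiction (y , x∈p∩q⁺ (y∈K , y∈B)) K∩B-empty
      (inj₂ y≡b) → y≡b

  IsMax? : ∀ C a → Dec (IsMax C a)
  IsMax? C a = (a ∈? C) ×-dec all? (λ b → (b ∈? C) →-dec ¬? (b ≻? a))

  IsTransitiveSubset? : ∀ A B → Dec (IsTransitiveSubset A B)
  IsTransitiveSubset? A B =
    (B ⊆? A) ×-dec allSubset? (λ C → nonempty? C →-dec ((C ⊆? B) →-dec any? (IsMax? C)))

  MaximalTransitive? : ∀ A B → Dec (MaximalTransitive A B)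
  MaximalTransitive? A B =
    IsTransitiveSubset? A B ×-dec
    allSubset? (λ B′ → IsTransitiveSubset? A B′ →-dec ((B ⊆? B′) →-dec (B′ ⊆? B)))

  BA? : ∀ A a → Dec (BA A a)
  BA? A a = anySubset? (λ B → MaximalTransitive? A B ×-dec IsMax? B a)

  Stable? : ∀ A X → Dec (Stable BA A X)
  Stable? A X =
    (X ⊆? A) ×-dec all? (λ a → (a ∈? A) →-dec (¬? (a ∈? X) →-dec ¬? (BA? (X ∪ ⁅ a ⁆) a)))

  MaximalTransitive⇒undominated : MaximalTransitive A B → z ∈ A → ¬ Dominates z B
  MaximalTransitive⇒undominated {B = B} {z} ((B⊆A , B-maxima) , B-maximal) z∈A z-dom =
    ¬Dominates-self z∈B z-dom
    where
    z∈B : z ∈ B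
    z∈B = B-maximal _ (∪⁅⁆-⊆ B⊆A z∈A , HasMaxima-∪-top B-maxima z-dom) ⊆-∪⁅⁆ (∈-∪⁅⁆ z)

  -- The maximum m of a maximal transitive B ⊇ C is a: if m ∉ C, it would dominate C.
  undominated⇒BA : IsTransitiveSubset A C → IsMax C a → (∀ z → z ∈ A → ¬ Dominates z C) → BA A a
  undominated⇒BA {A} {C} {a} C-trans a-max undominated
    with ⊆-maximal (IsTransitiveSubset? A) C C-trans
  ... | B , C⊆B , B-trans , B-maximal with proj₂ B-trans B (a , C⊆B (proj₁ a-max)) ⊆-refl
  ...   | m , m-max = B , (B-trans , B-maximal) , subst (IsMax B) m≡a m-max
    where
    m≡a : m ≡ a
    m≡a with m ∈? C
    ... | yes m∈C = IsMax-unique (IsMax-⊆ C⊆B m∈C m-max) a-max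
    ... | no m∉C =
      contradiction (IsMax⇒Dominates m-max C⊆B m∉C) (undominated m (proj₁ B-trans (proj₁ m-max)))

  BA-from-dominators : X ⊆ A → b ∈ X → a ∈ Dbar A b →
                       BA ((X ∩ Dbar A b) ∪ ⁅ a ⁆) a → BA (X ∪ ⁅ a ⁆) a
  BA-from-dominators {X} {A} {b} {a} X⊆A b∈X a∈D (B , B-maxTrans@((B⊆S , B-maxima) , _) , a-max) =
    undominated⇒BA (C⊆ , HasMaxima-∪-bottom B-maxima above-b)
                   (IsMax-∪-below (proj₂ (∈-Dbar⁻ a∈D)) a-max)
                   undominated
    where
    D : Subset n
    D = Dbar A b
    above-b : ∀ c → c ∈ B → c ≻ b
    above-b c c∈B = proj₂ (∈-Dbar⁻ (∪⁅⁆-⊆ (p∩q⊆q X D) a∈D (B⊆S c∈B)))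
    C⊆ : B ∪ ⁅ b ⁆ ⊆ X ∪ ⁅ a ⁆
    C⊆ = ∪⁅⁆-⊆ (⊆-trans B⊆S (∪⁅⁆-⊆ (⊆-trans (p∩q⊆p X D) ⊆-∪⁅⁆) (∈-∪⁅⁆ a))) (⊆-∪⁅⁆ b∈X)
    undominated : ∀ z → z ∈ X ∪ ⁅ a ⁆ → ¬ Dominates z (B ∪ ⁅ b ⁆)
    undominated z z∈ z-dom =
      MaximalTransitive⇒undominated B-maxTrans z∈S (λ c c∈B → z-dom c (⊆-∪⁅⁆ c∈B))
      where
      z∈S : z ∈ (X ∩ D) ∪ ⁅ a ⁆
      z∈S with ∈-∪⁅⁆⁻ z∈
      ... | inj₁ z∈X = ⊆-∪⁅⁆ (x∈p∩q⁺ (z∈X , ∈-Dbar⁺ (X⊆A z∈X) (z-dom b (∈-∪⁅⁆ b))))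
      ... | inj₂ refl = ∈-∪⁅⁆ a

  Stable-∩Dbar : Stable BA A X → b ∈ X → Stable BA (Dbar A b) (X ∩ Dbar A b)
  Stable-∩Dbar {A} {X} {b} (X⊆A , X-stable) b∈X = p∩q⊆q X (Dbar A b) , λ a a∈D a∉X∩D a∈BA →
    X-stable a (Dbar⊆ a∈D) (λ a∈X → a∉X∩D (x∈p∩q⁺ (a∈X , a∈D)))
             (BA-from-dominators X⊆A b∈X a∈D a∈BA)

  Stable-nonempty : Stable BA A X → a ∈ A → Nonempty X
  Stable-nonempty {A} {X} {a} (_ , X-stable) a∈A with nonempty? X
  ... | yes X≠∅ = X≠∅
  ... | no X-empty = contradiction a∈BA (X-stable a a∈A (λ a∈X → X-empty (a , a∈X)))
    where
    a-max : IsMax (X ∪ ⁅ a ⁆) a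
    a-max = ∈-∪⁅⁆ a , λ y y∈ y≻a → case ∈-∪⁅⁆⁻ y∈ of λ where
      (inj₁ y∈X) → X-empty (y , y∈X)
      (inj₂ refl) → ≻-irrefl y≻a
    a∈BA : BA (X ∪ ⁅ a ⁆) a
    a∈BA = undominated⇒BA
      (⊆-refl , HasMaxima-∪-top (λ _ (c , c∈C) C⊆X → ⊥-elim (X-empty (c , C⊆X c∈C)))
                                (λ c c∈X → ⊥-elim (X-empty (c , c∈X))))
      a-max (λ z z∈ → ¬Dominates-self z∈)

  Retentive-antimono : ∀ {S₁ S₂ : SolutionOn n} →
                       (∀ b → b ∈ A → ∀ x → S₁ (Dbar A b) x → S₂ (Dbar A b) x) →
                       Retentive S₂ A B → Retentive S₁ A B
  Retentive-antimono S₁⊆S₂ (B≠∅ , B⊆A , retain) =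
    B≠∅ , B⊆A , λ b b∈B D≠∅ x x∈S₁ → retain b b∈B D≠∅ x (S₁⊆S₂ b (B⊆A b∈B) x x∈S₁)

  ∣Dbar∣≤ : ∀ {k} → b ∈ A → ∣ A ∣ ≤ suc k → ∣ Dbar A b ∣ ≤ k
  ∣Dbar∣≤ b∈A ∣A∣≤ = ≤-pred (<-≤-trans (p⊂q⇒∣p∣<∣q∣ (Dbar⊂ b∈A)) ∣A∣≤)

  mutual
    TEQ-fuel-cong : ∀ k k′ → ∣ A ∣ ≤ k → ∣ A ∣ ≤ k′ → TEQ-fuel k A x → TEQ-fuel k′ A x
    TEQ-fuel-cong (suc k) 0 _ ∣A∣≤0 (_ , ((( y , y∈B) , B⊆A , _) , _) , _) =
      contradiction (<-≤-trans (x∈p⇒∣p-x∣<∣p∣ (B⊆A y∈B)) ∣A∣≤0) n≮0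
    TEQ-fuel-cong (suc k) (suc k′) ∣A∣≤ ∣A∣≤′ (B , (B-ret , B-minimal) , x∈B) =
      B , (Retentive-fuel-cong ∣A∣≤ ∣A∣≤′ B-ret ,
           λ B′ B′-ret → B-minimal B′ (Retentive-fuel-cong ∣A∣≤′ ∣A∣≤ B′-ret)) , x∈B

    Retentive-fuel-cong : ∀ {k k′} → ∣ A ∣ ≤ suc k → ∣ A ∣ ≤ suc k′ →
                          Retentive (TEQ-fuel k) A B → Retentive (TEQ-fuel k′) A B
    Retentive-fuel-cong {k = k} {k′} ∣A∣≤ ∣A∣≤′ =
      Retentive-antimono {S₁ = TEQ-fuel k′} {S₂ = TEQ-fuel k}
        λ b b∈A x → TEQ-fuel-cong k′ k (∣Dbar∣≤ b∈A ∣A∣≤′) (∣Dbar∣≤ b∈A ∣A∣≤)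

  MinimalRetentive-fuel⇒TEQ : ∀ {k} → ∣ A ∣ ≤ suc k →
                              MinimalRetentive (TEQ-fuel k) A B → MinimalRetentive TEQ A B
  MinimalRetentive-fuel⇒TEQ {A} {k = k} ∣A∣≤ (B-ret , B-minimal) =
    Retentive-antimono {S₁ = TEQ} {S₂ = TEQ-fuel k} TEQ⇒fuel B-ret ,
    λ B′ B′-ret → B-minimal B′ (Retentive-antimono {S₁ = TEQ-fuel k} {S₂ = TEQ} fuel⇒TEQ B′-ret)
    where
    TEQ⇒fuel : ∀ b → b ∈ A → ∀ x → TEQ (Dbar A b) x → TEQ-fuel k (Dbar A b) x
    TEQ⇒fuel b b∈A x = TEQ-fuel-cong _ k ≤-refl (∣Dbar∣≤ b∈A ∣A∣≤)
    fuel⇒TEQ : ∀ b → b ∈ A → ∀ x → TEQ-fuel k (Dbar A b) x → TEQ (Dbar A b) x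
    fuel⇒TEQ b b∈A x = TEQ-fuel-cong k _ (∣Dbar∣≤ b∈A ∣A∣≤) ≤-refl

  -- ∣ A ∣ is not syntactically a successor, so the fuel is first raised to suc ∣ A ∣.
  TEQ-unfold : TEQ A x → ∃[ B ] (MinimalRetentive TEQ A B × x ∈ B)
  TEQ-unfold {A} x∈TEQ =
    let B , B-minimal , x∈B = TEQ-fuel-cong ∣ A ∣ (suc ∣ A ∣) ≤-refl (n≤1+n _) x∈TEQ
    in B , MinimalRetentive-fuel⇒TEQ (n≤1+n _) B-minimal , x∈B

  MinimalRetentive⊆Retentive : RTEQ-Directed → MinimalRetentive TEQ A R → Retentive TEQ A X → R ⊆ X
  MinimalRetentive⊆Retentive {A} {R} {X} directed (R-ret@((r , r∈R) , R⊆A , _) , R-minimal) X-ret =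
    let T = record { n = n ; rel = tr ; A = A ; A-nonempty = r , R⊆A r∈R }
        D , D-ret , D⊆R∩X = directed T R X R-ret X-ret
        R⊆D = R-minimal D D-ret (⊆-trans D⊆R∩X (p∩q⊆p R X))
    in ⊆-trans R⊆D (⊆-trans D⊆R∩X (p∩q⊆q R X))

  Stable⇒Retentive : (∀ {b} → b ∈ A → ∀ {Y y} → Stable BA (Dbar A b) Y → TEQ (Dbar A b) y → y ∈ Y) →
                     Stable BA A X → Nonempty A → Retentive TEQ A X
  Stable⇒Retentive {A} {X} TEQ⊆stable X-stable@(X⊆A , _) (a , a∈A) =
    Stable-nonempty X-stable a∈A , X⊆A , λ b b∈X _ y y∈TEQ →
      proj₁ (x∈p∩q⁻ X (Dbar A b) (TEQ⊆stable (X⊆A b∈X) (Stable-∩Dbar X-stable b∈X) y∈TEQ))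

  TEQ⊆Stable : RTEQ-Directed → Acc _⊂_ A → Stable BA A X → TEQ A x → x ∈ X
  TEQ⊆Stable {x = x} directed (acc smaller) X-stable x∈TEQ =
    let R , R-minimal , x∈R = TEQ-unfold x∈TEQ
        R⊆A = proj₁ (proj₂ (proj₁ R-minimal))
        X-ret = Stable⇒Retentive (λ b∈A → TEQ⊆Stable directed (smaller (Dbar⊂ b∈A)))
                                 X-stable (x , R⊆A x∈R)
    in MinimalRetentive⊆Retentive directed R-minimal X-ret x∈R

  TEQ⊆ME : RTEQ-Directed → TEQ A x → ME A x
  TEQ⊆ME {A} directed x∈TEQ =
    let M , _ , M-stable , M-minimal = ⊆-minimal (Stable? A) A (⊆-refl , λ _ a∈A a∉A _ → a∉A a∈A)
    in M , (M-stable , M-minimal) , TEQ⊆Stable directed (⊂-wellFounded A) M-stable x∈TEQ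

corollary2 : RTEQ-Directed →
    ∀ (T : Tournament) (a : Fin (Tournament.n T)) → TEQof T a → MEof T a
corollary2 directed T a = Tournaments.TEQ⊆ME (Tournament.rel T) directed
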